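{- For every word $w\in\mathfrak{H}^0$ we have $\zeta^{\mathrm{OOZ}}(w)=\zeta^{\mathrm{SZ},\star}(\widetilde\tau(w))$.
   Context: Let $\mathfrak{H}=\mathbb{Q}\langle p,y\rangle$, $\mathfrak{H}^0=\mathbb{Q}\mathbf{1}\oplus p\mathfrak{H}y$, and $z_k:=p^ky$ for $k\ge0$, so that $\mathfrak{H}^0$ is spanned by $\mathbf{1}$ and the words $z_{k_1}\cdots z_{k_n}$ with $k_1\ge1$, $k_2,\dots,k_n\ge0$. Let $\widetilde\tau$ be the anti-automorphism of $\mathfrak{H}$ with $\widetilde\tau(p)=y$, $\widetilde\tau(y)=p$ (it maps $\mathfrak{H}^0$ to itself). Define linear maps $\zeta^{\mathrm{OOZ}},\zeta^{\mathrm{SZ},\star}\colon\mathfrak{H}^0\to\mathbb{Q}[[q]]$ by sending $\mathbf{1}$ to $1$ and, for $k_1\ge1$, $k_j\ge0$, $\zeta^{\mathrm{OOZ}}(z_{k_1}\cdots z_{k_n})=\sum_{m_1>\cdots>m_n>0}\frac{q^{m_1}}{(1-q^{m_1})^{k_1}\cdots(1-q^{m_n})^{k_n}}$, $\zeta^{\mathrm{SZ},\star}(z_{k_1}\cdots z_{k_n})=\sum_{m_1\ge\cdots\ge m_n>0}\prod_{i=1}^n\frac{q^{m_ik_i}}{(1-q^{m_i})^{k_i}}$. -}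

module Defs where

open import Data.Nat using (ℕ; zero; suc; _∸_)
open import Data.Nat.Divisibility using (_∣?_)
open import Data.Rational using (ℚ; 0ℚ; 1ℚ; _+_; _*_)
open import Data.List using (List; []; _∷_; _++_; [_]; reverse; map)
open import Data.Product using (∃-syntax)
open import Data.Sum using (_⊎_)
open import Relation.Nullary.Decidable using (does)
open import Data.Bool using (if_then_else_)
open import Relation.Binary.PropositionalEquality using (_≡_)

data Letter : Set where
  p y : Letter

Word : Set
Word = List Letter

-- w is a word of ℌ⁰ = ℚ1 ⊕ pℌy : either empty or of the form p u y
InH0 : Word → Set
InH0 w = (w ≡ []) ⊎ (∃[ u ] (w ≡ p ∷ (u ++ [ y ])))

swap : Letter → Letter
swap p = y
swap y = p

τ̃ : Word → Word
τ̃ w = reverse (map swap w)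

-- decode a word ending in y as z_{k₁} ⋯ z_{kₙ} (z_k = p^k y); returns [k₁,…,kₙ]
-- (the counter c is the number of p's read since the last y)
toZs′ : ℕ → Word → List ℕ
toZs′ c []      = []
toZs′ c (p ∷ w) = toZs′ (suc c) w
toZs′ c (y ∷ w) = c ∷ toZs′ 0 w

toZs : Word → List ℕ
toZs = toZs′ 0

Series : Set
Series = ℕ → ℚ

sumTo : ℕ → (ℕ → ℚ) → ℚ
sumTo zero    f = f 0
sumTo (suc n) f = sumTo n f + f (suc n)

sumFrom1 : ℕ → (ℕ → Series) → Series
sumFrom1 zero    F j = 0ℚ
sumFrom1 (suc b) F j = sumFrom1 b F j + F (suc b) j

one : Series
one zero    = 1ℚ
one (suc _) = 0ℚ

_⊛_ : Series → Series → Series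
(f ⊛ g) n = sumTo n (λ i → f i * g (n ∸ i))

infixl 7 _⊛_

_^s_ : Series → ℕ → Series
f ^s zero  = one
f ^s suc k = f ⊛ (f ^s k)

qpow : ℕ → Series
qpow m j = if does (m Data.Nat.≟ j) then 1ℚ else 0ℚ

-- 1/(1 - q^m) = Σ_{a ≥ 0} q^{m a}   (used only for m ≥ 1)
invOneMinusQ : ℕ → Series
invOneMinusQ m j = if does (m ∣? j) then 1ℚ else 0ℚ

-- Partial sums of the two q-analogues, truncated to m₁ ≤ M.
-- ζ is the q-adic limit of these as M → ∞; the coefficient of q^N of the
-- limit equals that of the M-th partial sum for every M ≥ N.

-- Σ_{b ≥ m₁ > m₂ > ⋯ > mₙ > 0} ∏ 1/(1-q^{mᵢ})^{kᵢ}
strictSum : List ℕ → ℕ → Series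
strictSum []       b = one
strictSum (k ∷ ks) b =
  sumFrom1 b (λ m → (invOneMinusQ m ^s k) ⊛ strictSum ks (m ∸ 1))

-- Σ_{b ≥ m₁ ≥ m₂ ≥ ⋯ ≥ mₙ > 0} ∏ q^{mᵢkᵢ}/(1-q^{mᵢ})^{kᵢ}
weakSum : List ℕ → ℕ → Series
weakSum []       b = one
weakSum (k ∷ ks) b =
  sumFrom1 b (λ m → ((qpow m ⊛ invOneMinusQ m) ^s k) ⊛ weakSum ks m)

ζOOZ-partial : ℕ → Word → Series
ζOOZ-partial M w with toZs w
... | []       = one
... | k ∷ ks   = sumFrom1 M (λ m → qpow m ⊛ (invOneMinusQ m ^s k) ⊛ strictSum ks (m ∸ 1))

ζSZ⋆-partial : ℕ → Word → Series
ζSZ⋆-partial M w = weakSum (toZs w) M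

{-# OPTIONS --safe #-}
-- Both sides are compared through the connected sum
--   C(x, w) = Σ_{v,u ≤ M} q^{vu} S(x; v) O(w; u),
-- where O(w; u) is the part of ζ^OOZ(w) with top index m₁ = u (stripped of its q^u) and
-- S(x; v) the part of ζ^{SZ,⋆}(x) with top index v.  For x = 1 the connector leaves
-- Σ_u q^u O(w; u) = ζ^OOZ(w); for w = 1 it leaves Σ_v S(x; v) = ζ^{SZ,⋆}(x).
-- Moving the first letter of w, exchanged p ↔ y, to the front of x does not change C
-- modulo q^{M+1}: both moves are the geometric series Σ_{v ≥ a} q^{vc} = q^{ac}/(1 - q^c)
-- cut off at v ≤ M.  Moving every letter turns C(1, w) into C(τ̃ w, 1).
module Submission where

open import Defs
open import Data.Nat using (ℕ; _≤_)
open import Relation.Binary.PropositionalEquality using (_≡_)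

open import Algebra.Bundles using (CommutativeMonoid)
import Algebra.Properties.CommutativeSemigroup as CommutativeSemigroupProperties
open import Data.Bool using (Bool; true; false; if_then_else_; T)
open import Data.List using (List; []; _∷_; _++_; [_]; reverse; map)
import Data.List.Properties as Listₚ
import Data.Nat as ℕ
open import Data.Nat using (zero; suc; _+_; _*_; _∸_; _<_; _<ᵇ_; z≤n; s≤s; NonZero)
import Data.Nat.Divisibility as ℕ∣
import Data.Nat.Properties as ℕₚ
open import Data.Product using (∃-syntax; _,_)
open import Data.Rational using (ℚ; 0ℚ; 1ℚ) renaming (_+_ to _+ℚ_; _*_ to _*ℚ_)
import Data.Rational.Properties as ℚₚ
open import Data.Sum using (_⊎_; inj₁; inj₂)
open import Function using (_∘_; const; id)
open import Function.Bundles using (mk⇔)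
open import Relation.Binary.Bundles using (Setoid)
import Relation.Binary.Reasoning.Setoid as SetoidReasoning
open import Relation.Binary.PropositionalEquality
  using (_≢_; refl; sym; trans; cong; cong₂; subst; _≗_; _→-setoid_; module ≡-Reasoning)
open import Relation.Nullary using (¬_; yes; no; contradiction)
open import Relation.Nullary.Decidable using (dec-true; dec-false; does-⇔)

sumTo-cong : ∀ n {f g : ℕ → ℚ} → (∀ i → i ≤ n → f i ≡ g i) → sumTo n f ≡ sumTo n g
sumTo-cong zero    f≡g = f≡g 0 z≤n
sumTo-cong (suc n) f≡g =
  cong₂ _+ℚ_ (sumTo-cong n (λ i i≤n → f≡g i (ℕₚ.m≤n⇒m≤1+n i≤n))) (f≡g (suc n) ℕₚ.≤-refl)

sumTo-unfoldˡ : ∀ n (f : ℕ → ℚ) → sumTo (suc n) f ≡ f 0 +ℚ sumTo n (f ∘ suc)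
sumTo-unfoldˡ zero    f = refl
sumTo-unfoldˡ (suc n) f = trans (cong (_+ℚ f (suc (suc n))) (sumTo-unfoldˡ n f))
                                (ℚₚ.+-assoc (f 0) (sumTo n (f ∘ suc)) (f (suc (suc n))))

sumTo-distrib-+ : ∀ n (f g : ℕ → ℚ) → sumTo n (λ i → f i +ℚ g i) ≡ sumTo n f +ℚ sumTo n g
sumTo-distrib-+ zero    f g = refl
sumTo-distrib-+ (suc n) f g =
  trans (cong (_+ℚ (f (suc n) +ℚ g (suc n))) (sumTo-distrib-+ n f g))
        (interchange (sumTo n f) (sumTo n g) (f (suc n)) (g (suc n)))
  where open CommutativeSemigroupProperties (CommutativeMonoid.commutativeSemigroup ℚₚ.+-0-commutativeMonoid)
          using (interchange)

*-distribˡ-sumTo : ∀ n c (f : ℕ → ℚ) → c *ℚ sumTo n f ≡ sumTo n (λ i → c *ℚ f i)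
*-distribˡ-sumTo zero    c f = refl
*-distribˡ-sumTo (suc n) c f =
  trans (ℚₚ.*-distribˡ-+ c (sumTo n f) (f (suc n))) (cong (_+ℚ c *ℚ f (suc n)) (*-distribˡ-sumTo n c f))

*-distribʳ-sumTo : ∀ n c (f : ℕ → ℚ) → sumTo n f *ℚ c ≡ sumTo n (λ i → f i *ℚ c)
*-distribʳ-sumTo zero    c f = refl
*-distribʳ-sumTo (suc n) c f =
  trans (ℚₚ.*-distribʳ-+ c (sumTo n f) (f (suc n))) (cong (_+ℚ f (suc n) *ℚ c) (*-distribʳ-sumTo n c f))

sumTo-zero : ∀ n → sumTo n (const 0ℚ) ≡ 0ℚ
sumTo-zero zero    = refl
sumTo-zero (suc n) = trans (cong (_+ℚ 0ℚ) (sumTo-zero n)) (ℚₚ.+-identityʳ 0ℚ)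

sumTo-reverse : ∀ n (f : ℕ → ℚ) → sumTo n f ≡ sumTo n (λ i → f (n ∸ i))
sumTo-reverse zero    f = refl
sumTo-reverse (suc n) f = begin
  sumTo n f +ℚ f (suc n)                      ≡⟨ cong (_+ℚ f (suc n)) (sumTo-reverse n f) ⟩
  sumTo n (λ i → f (n ∸ i)) +ℚ f (suc n)      ≡⟨ ℚₚ.+-comm (sumTo n (λ i → f (n ∸ i))) (f (suc n)) ⟩
  f (suc n) +ℚ sumTo n (λ i → f (n ∸ i))      ≡⟨ sumTo-unfoldˡ n (λ i → f (suc n ∸ i)) ⟨
  sumTo (suc n) (λ i → f (suc n ∸ i))         ∎
  where open ≡-Reasoning

sumTo-triangle : ∀ n (F : ℕ → ℕ → ℚ) →
  sumTo n (λ k → sumTo k (λ i → F i k)) ≡ sumTo n (λ i → sumTo (n ∸ i) (λ l → F i (i + l)))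
sumTo-triangle zero    F = refl
sumTo-triangle (suc n) F = begin
  sumTo n (λ k → sumTo k (λ i → F i k)) +ℚ (sumTo n (λ i → F i (suc n)) +ℚ F (suc n) (suc n))
    ≡⟨ cong (_+ℚ (sumTo n (λ i → F i (suc n)) +ℚ F (suc n) (suc n))) (sumTo-triangle n F) ⟩
  rowSums n +ℚ (sumTo n (λ i → F i (suc n)) +ℚ F (suc n) (suc n))
    ≡⟨ ℚₚ.+-assoc (rowSums n) _ _ ⟨
  (rowSums n +ℚ sumTo n (λ i → F i (suc n))) +ℚ F (suc n) (suc n)
    ≡⟨ cong₂ _+ℚ_ (sumTo-distrib-+ n _ _) (cong (F (suc n)) (ℕₚ.+-identityʳ (suc n))) ⟨
  sumTo n (λ i → sumTo (n ∸ i) (λ l → F i (i + l)) +ℚ F i (suc n)) +ℚ F (suc n) (suc n + 0)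
    ≡⟨ cong₂ _+ℚ_ (sumTo-cong n extend)
                  (cong (λ m → sumTo m (λ l → F (suc n) (suc n + l))) (ℕₚ.n∸n≡0 n)) ⟨
  sumTo n (λ i → sumTo (suc n ∸ i) (λ l → F i (i + l))) +ℚ sumTo (suc n ∸ suc n) (λ l → F (suc n) (suc n + l))
    ∎
  where
  open ≡-Reasoning
  rowSums : ℕ → ℚ
  rowSums m = sumTo m (λ i → sumTo (m ∸ i) (λ l → F i (i + l)))
  extend : ∀ i → i ≤ n →
    sumTo (suc n ∸ i) (λ l → F i (i + l)) ≡ sumTo (n ∸ i) (λ l → F i (i + l)) +ℚ F i (suc n)
  extend i i≤n rewrite ℕₚ.+-∸-assoc 1 i≤n =
    cong (λ m → sumTo (n ∸ i) (λ l → F i (i + l)) +ℚ F i m)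
         (trans (ℕₚ.+-suc i (n ∸ i)) (cong suc (ℕₚ.m+[n∸m]≡n i≤n)))

-- The semiring of power series

infixl 6 _⊕_
infix  4 _≈[_]_

𝟘 : Series
𝟘 = const 0ℚ

_⊕_ : Series → Series → Series
(f ⊕ g) j = f j +ℚ g j

module ≗-Reasoning = SetoidReasoning (ℕ →-setoid ℚ)
open Setoid (ℕ →-setoid ℚ) using () renaming (sym to ≗-sym; trans to ≗-trans)

⊕-cong : ∀ {f f′ g g′} → f ≗ f′ → g ≗ g′ → f ⊕ g ≗ f′ ⊕ g′
⊕-cong f≗f′ g≗g′ j = cong₂ _+ℚ_ (f≗f′ j) (g≗g′ j)

⊕-congˡ : ∀ {f f′} g → f ≗ f′ → f ⊕ g ≗ f′ ⊕ g
⊕-congˡ g f≗f′ j = cong (_+ℚ g j) (f≗f′ j)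

⊕-congʳ : ∀ f {g g′} → g ≗ g′ → f ⊕ g ≗ f ⊕ g′
⊕-congʳ f g≗g′ j = cong (f j +ℚ_) (g≗g′ j)

⊕-comm : ∀ f g → f ⊕ g ≗ g ⊕ f
⊕-comm f g j = ℚₚ.+-comm (f j) (g j)

⊕-assoc : ∀ f g h → (f ⊕ g) ⊕ h ≗ f ⊕ (g ⊕ h)
⊕-assoc f g h j = ℚₚ.+-assoc (f j) (g j) (h j)

⊕-identityˡ : ∀ f → 𝟘 ⊕ f ≗ f
⊕-identityˡ f j = ℚₚ.+-identityˡ (f j)

⊕-identityʳ : ∀ f → f ⊕ 𝟘 ≗ f
⊕-identityʳ f j = ℚₚ.+-identityʳ (f j)

⊛-cong : ∀ {f f′ g g′} → f ≗ f′ → g ≗ g′ → f ⊛ g ≗ f′ ⊛ g′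
⊛-cong f≗f′ g≗g′ n = sumTo-cong n (λ i _ → cong₂ _*ℚ_ (f≗f′ i) (g≗g′ (n ∸ i)))

⊛-congˡ : ∀ {f f′} g → f ≗ f′ → f ⊛ g ≗ f′ ⊛ g
⊛-congˡ g f≗f′ n = sumTo-cong n (λ i _ → cong (_*ℚ g (n ∸ i)) (f≗f′ i))

⊛-congʳ : ∀ f {g g′} → g ≗ g′ → f ⊛ g ≗ f ⊛ g′
⊛-congʳ f g≗g′ n = sumTo-cong n (λ i _ → cong (f i *ℚ_) (g≗g′ (n ∸ i)))

⊛-comm : ∀ f g → f ⊛ g ≗ g ⊛ f
⊛-comm f g n = begin
  sumTo n (λ i → f i *ℚ g (n ∸ i))                ≡⟨ sumTo-reverse n _ ⟩
  sumTo n (λ i → f (n ∸ i) *ℚ g (n ∸ (n ∸ i)))    ≡⟨ sumTo-cong n swapFactors ⟩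
  sumTo n (λ i → g i *ℚ f (n ∸ i))                ∎
  where
  open ≡-Reasoning
  swapFactors : ∀ i → i ≤ n → f (n ∸ i) *ℚ g (n ∸ (n ∸ i)) ≡ g i *ℚ f (n ∸ i)
  swapFactors i i≤n = trans (cong (λ k → f (n ∸ i) *ℚ g k) (ℕₚ.m∸[m∸n]≡n i≤n)) (ℚₚ.*-comm (f (n ∸ i)) (g i))

⊛-assoc : ∀ f g h → (f ⊛ g) ⊛ h ≗ f ⊛ (g ⊛ h)
⊛-assoc f g h n = begin
  sumTo n (λ k → sumTo k (λ i → f i *ℚ g (k ∸ i)) *ℚ h (n ∸ k))
    ≡⟨ sumTo-cong n (λ k _ → *-distribʳ-sumTo k (h (n ∸ k)) _) ⟩
  sumTo n (λ k → sumTo k (λ i → f i *ℚ g (k ∸ i) *ℚ h (n ∸ k)))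
    ≡⟨ sumTo-triangle n (λ i k → f i *ℚ g (k ∸ i) *ℚ h (n ∸ k)) ⟩
  sumTo n (λ i → sumTo (n ∸ i) (λ l → f i *ℚ g (i + l ∸ i) *ℚ h (n ∸ (i + l))))
    ≡⟨ sumTo-cong n (λ i _ → sumTo-cong (n ∸ i) (λ l _ → reindex i l)) ⟩
  sumTo n (λ i → sumTo (n ∸ i) (λ l → f i *ℚ (g l *ℚ h (n ∸ i ∸ l))))
    ≡⟨ sumTo-cong n (λ i _ → *-distribˡ-sumTo (n ∸ i) (f i) _) ⟨
  sumTo n (λ i → f i *ℚ sumTo (n ∸ i) (λ l → g l *ℚ h (n ∸ i ∸ l)))
    ∎
  where
  open ≡-Reasoning
  reindex : ∀ i l → f i *ℚ g (i + l ∸ i) *ℚ h (n ∸ (i + l)) ≡ f i *ℚ (g l *ℚ h (n ∸ i ∸ l))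
  reindex i l = trans (cong₂ (λ a b → f i *ℚ g a *ℚ h b) (ℕₚ.m+n∸m≡n i l) (sym (ℕₚ.∸-+-assoc n i l)))
                      (ℚₚ.*-assoc (f i) (g l) (h (n ∸ i ∸ l)))

⊛-distribˡ-⊕ : ∀ f g h → f ⊛ (g ⊕ h) ≗ f ⊛ g ⊕ f ⊛ h
⊛-distribˡ-⊕ f g h n =
  trans (sumTo-cong n (λ i _ → ℚₚ.*-distribˡ-+ (f i) (g (n ∸ i)) (h (n ∸ i)))) (sumTo-distrib-+ n _ _)

⊛-distribʳ-⊕ : ∀ f g h → (g ⊕ h) ⊛ f ≗ g ⊛ f ⊕ h ⊛ f
⊛-distribʳ-⊕ f g h n =
  trans (sumTo-cong n (λ i _ → ℚₚ.*-distribʳ-+ (f (n ∸ i)) (g i) (h i))) (sumTo-distrib-+ n _ _)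

⊛-zeroʳ : ∀ f → f ⊛ 𝟘 ≗ 𝟘
⊛-zeroʳ f n = trans (sumTo-cong n (λ i _ → ℚₚ.*-zeroʳ (f i))) (sumTo-zero n)

⊛-zeroˡ : ∀ f → 𝟘 ⊛ f ≗ 𝟘
⊛-zeroˡ f n = trans (⊛-comm 𝟘 f n) (⊛-zeroʳ f n)

⊛⊛-zero₂ : ∀ f {g} h → g ≗ 𝟘 → f ⊛ (g ⊛ h) ≗ 𝟘
⊛⊛-zero₂ f h g≗𝟘 = ≗-trans (⊛-congʳ f (≗-trans (⊛-congˡ h g≗𝟘) (⊛-zeroˡ h))) (⊛-zeroʳ f)

⊛⊛-zero₃ : ∀ f g {h} → h ≗ 𝟘 → f ⊛ (g ⊛ h) ≗ 𝟘
⊛⊛-zero₃ f g h≗𝟘 = ≗-trans (⊛-congʳ f (≗-trans (⊛-congʳ g h≗𝟘) (⊛-zeroʳ g))) (⊛-zeroʳ f)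

_≈[_]_ : Series → ℕ → Series → Set
f ≈[ M ] g = ∀ j → j ≤ M → f j ≡ g j

≈[]-setoid : ℕ → Setoid _ _
≈[]-setoid M = record
  { Carrier       = Series
  ; _≈_           = _≈[ M ]_
  ; isEquivalence = record
    { refl  = λ _ _ → refl
    ; sym   = λ f≈g j j≤M → sym (f≈g j j≤M)
    ; trans = λ f≈g g≈h j j≤M → trans (f≈g j j≤M) (g≈h j j≤M)
    }
  }

≗⇒≈[] : ∀ M {f g} → f ≗ g → f ≈[ M ] g
≗⇒≈[] M f≗g j _ = f≗g j

⊕-cong-≈[] : ∀ {M f f′ g g′} → f ≈[ M ] f′ → g ≈[ M ] g′ → f ⊕ g ≈[ M ] f′ ⊕ g′
⊕-cong-≈[] f≈f′ g≈g′ j j≤M = cong₂ _+ℚ_ (f≈f′ j j≤M) (g≈g′ j j≤M)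

⊕-congʳ-≈[] : ∀ {M} f {g g′} → g ≈[ M ] g′ → f ⊕ g ≈[ M ] f ⊕ g′
⊕-congʳ-≈[] f g≈g′ j j≤M = cong (f j +ℚ_) (g≈g′ j j≤M)

⊛-congˡ-≈[] : ∀ {M f f′} g → f ≈[ M ] f′ → f ⊛ g ≈[ M ] f′ ⊛ g
⊛-congˡ-≈[] g f≈f′ n n≤M = sumTo-cong n (λ i i≤n → cong (_*ℚ g (n ∸ i)) (f≈f′ i (ℕₚ.≤-trans i≤n n≤M)))

qpow-≡ : ∀ a → qpow a a ≡ 1ℚ
qpow-≡ a = cong (if_then 1ℚ else 0ℚ) (dec-true (a ℕ.≟ a) refl)

qpow-≢ : ∀ {a i} → a ≢ i → qpow a i ≡ 0ℚ
qpow-≢ {a} {i} a≢i = cong (if_then 1ℚ else 0ℚ) (dec-false (a ℕ.≟ i) a≢i)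

sumTo-qpow-< : ∀ a n (g : ℕ → ℚ) → n < a → sumTo n (λ i → qpow a i *ℚ g i) ≡ 0ℚ
sumTo-qpow-< a n g n<a = trans (sumTo-cong n vanish) (sumTo-zero n)
  where
  vanish : ∀ i → i ≤ n → qpow a i *ℚ g i ≡ 0ℚ
  vanish i i≤n = trans (cong (_*ℚ g i) (qpow-≢ (ℕₚ.>⇒≢ (ℕₚ.≤-<-trans i≤n n<a)))) (ℚₚ.*-zeroˡ (g i))

sumTo-qpow : ∀ a n (g : ℕ → ℚ) → a ≤ n → sumTo n (λ i → qpow a i *ℚ g i) ≡ g a
sumTo-qpow a n g a≤n with ℕₚ.m≤n⇒m<n∨m≡n a≤n
sumTo-qpow a (suc n) g _ | inj₁ (s≤s a≤n) = begin
  sumTo n (λ i → qpow a i *ℚ g i) +ℚ qpow a (suc n) *ℚ g (suc n)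
    ≡⟨ cong₂ (λ s t → s +ℚ t *ℚ g (suc n)) (sumTo-qpow a n g a≤n) (qpow-≢ (ℕₚ.<⇒≢ (s≤s a≤n))) ⟩
  g a +ℚ 0ℚ *ℚ g (suc n)
    ≡⟨ cong (g a +ℚ_) (ℚₚ.*-zeroˡ (g (suc n))) ⟩
  g a +ℚ 0ℚ
    ≡⟨ ℚₚ.+-identityʳ (g a) ⟩
  g a ∎
  where open ≡-Reasoning
sumTo-qpow zero zero g _ | inj₂ refl = ℚₚ.*-identityˡ (g 0)
sumTo-qpow (suc n) (suc n) g _ | inj₂ refl = begin
  sumTo n (λ i → qpow (suc n) i *ℚ g i) +ℚ qpow (suc n) (suc n) *ℚ g (suc n)
    ≡⟨ cong₂ (λ s t → s +ℚ t *ℚ g (suc n)) (sumTo-qpow-< (suc n) n g ℕₚ.≤-refl) (qpow-≡ (suc n)) ⟩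
  0ℚ +ℚ 1ℚ *ℚ g (suc n)
    ≡⟨ ℚₚ.+-identityˡ _ ⟩
  1ℚ *ℚ g (suc n)
    ≡⟨ ℚₚ.*-identityˡ (g (suc n)) ⟩
  g (suc n) ∎
  where open ≡-Reasoning

qpow-⊛ : ∀ a f {j} → a ≤ j → (qpow a ⊛ f) j ≡ f (j ∸ a)
qpow-⊛ a f {j} = sumTo-qpow a j (λ i → f (j ∸ i))

qpow-⊛-< : ∀ a f {j} → j < a → (qpow a ⊛ f) j ≡ 0ℚ
qpow-⊛-< a f {j} = sumTo-qpow-< a j (λ i → f (j ∸ i))

qpow-⊛-≈[] : ∀ {M a} f → M < a → qpow a ⊛ f ≈[ M ] 𝟘
qpow-⊛-≈[] {a = a} f M<a j j≤M = qpow-⊛-< a f (ℕₚ.≤-<-trans j≤M M<a)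

qpow-cong : ∀ {a b} → a ≡ b → qpow a ≗ qpow b
qpow-cong a≡b j = cong (λ a → qpow a j) a≡b

one≗qpow0 : one ≗ qpow 0
one≗qpow0 zero    = refl
one≗qpow0 (suc j) = refl

⊛-identityˡ : ∀ f → one ⊛ f ≗ f
⊛-identityˡ f j = trans (⊛-congˡ f one≗qpow0 j) (qpow-⊛ 0 f z≤n)

⊛-identityʳ : ∀ f → f ⊛ one ≗ f
⊛-identityʳ f j = trans (⊛-comm f one j) (⊛-identityˡ f j)

⊛-commutativeMonoid : CommutativeMonoid _ _
⊛-commutativeMonoid = record
  { Carrier             = Series
  ; _≈_                 = _≗_
  ; _∙_                 = _⊛_
  ; ε                   = one
  ; isCommutativeMonoid = record
    { isMonoid = record
      { isSemigroup = record
        { isMagma = record { isEquivalence = Setoid.isEquivalence (ℕ →-setoid ℚ) ; ∙-cong = ⊛-cong }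
        ; assoc   = ⊛-assoc
        }
      ; identity = ⊛-identityˡ , ⊛-identityʳ
      }
    ; comm = ⊛-comm
    }
  }

open import Algebra.Solver.CommutativeMonoid ⊛-commutativeMonoid using (solve; _⊜_) renaming (_⊕_ to _⊙_)

qpow-+ : ∀ a b → qpow a ⊛ qpow b ≗ qpow (a + b)
qpow-+ a b j with a ℕ.≤? j
... | yes a≤j = trans (qpow-⊛ a (qpow b) a≤j) (cong (if_then 1ℚ else 0ℚ) (does-⇔ (mk⇔ to from) (b ℕ.≟ j ∸ a) (a + b ℕ.≟ j)))
  where
  to : b ≡ j ∸ a → a + b ≡ j
  to b≡j∸a = trans (cong (a +_) b≡j∸a) (ℕₚ.m+[n∸m]≡n a≤j)
  from : a + b ≡ j → b ≡ j ∸ a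
  from a+b≡j = trans (sym (ℕₚ.m+n∸m≡n a b)) (cong (_∸ a) a+b≡j)
... | no a≰j = trans (qpow-⊛-< a (qpow b) j<a)
                     (sym (qpow-≢ (ℕₚ.>⇒≢ (ℕₚ.<-≤-trans j<a (ℕₚ.m≤m+n a b)))))
  where j<a = ℕₚ.≰⇒> a≰j

invOneMinusQ-zero : invOneMinusQ 0 ≗ one
invOneMinusQ-zero zero    = refl
invOneMinusQ-zero (suc j) = refl

invOneMinusQ-unfold : ∀ u .{{_ : NonZero u}} → invOneMinusQ u ≗ one ⊕ qpow u ⊛ invOneMinusQ u
invOneMinusQ-unfold u zero = begin
  invOneMinusQ u 0                        ≡⟨ cong (if_then 1ℚ else 0ℚ) (dec-true (u ℕ∣.∣? 0) (u ℕ∣.∣0)) ⟩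
  1ℚ                                      ≡⟨ ℚₚ.+-identityʳ 1ℚ ⟨
  1ℚ +ℚ 0ℚ                                ≡⟨ cong (1ℚ +ℚ_) (qpow-⊛-< u (invOneMinusQ u) (ℕ.>-nonZero⁻¹ u)) ⟨
  1ℚ +ℚ (qpow u ⊛ invOneMinusQ u) 0       ∎
  where open ≡-Reasoning
invOneMinusQ-unfold u j@(suc _) with u ℕ.≤? j
... | yes u≤j = trans (cong (if_then 1ℚ else 0ℚ) (does-⇔ (mk⇔ to from) (u ℕ∣.∣? j) (u ℕ∣.∣? (j ∸ u))))
                      (sym (trans (cong (0ℚ +ℚ_) (qpow-⊛ u (invOneMinusQ u) u≤j)) (ℚₚ.+-identityˡ _)))
  where
  to : u ℕ∣.∣ j → u ℕ∣.∣ (j ∸ u)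
  to u∣j = ℕ∣.∣m+n∣m⇒∣n (subst (u ℕ∣.∣_) (sym (ℕₚ.m+[n∸m]≡n u≤j)) u∣j) ℕ∣.∣-refl
  from : u ℕ∣.∣ (j ∸ u) → u ℕ∣.∣ j
  from u∣j∸u = ℕ∣.∣m∸n∣n⇒∣m u u≤j u∣j∸u ℕ∣.∣-refl
... | no u≰j = trans (cong (if_then 1ℚ else 0ℚ) (dec-false (u ℕ∣.∣? j) (u≰j ∘ ℕ∣.∣⇒≤)))
                     (sym (trans (cong (0ℚ +ℚ_) (qpow-⊛-< u (invOneMinusQ u) (ℕₚ.≰⇒> u≰j))) (ℚₚ.+-identityʳ 0ℚ)))

∑< : ℕ → (ℕ → Series) → Series
∑< zero    F = 𝟘
∑< (suc n) F = ∑< n F ⊕ F n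

infixl 10 ∑<
syntax ∑< n (λ i → F) = ∑[ i < n ] F

∑-cong : ∀ n {F G : ℕ → Series} → (∀ i → i < n → F i ≗ G i) → ∑< n F ≗ ∑< n G
∑-cong zero    F≗G = λ _ → refl
∑-cong (suc n) F≗G = ⊕-cong (∑-cong n (λ i i<n → F≗G i (ℕₚ.m<n⇒m<1+n i<n))) (F≗G n (ℕₚ.n<1+n n))

∑-cong-≈[] : ∀ n {M} {F G : ℕ → Series} → (∀ i → i < n → F i ≈[ M ] G i) → ∑< n F ≈[ M ] ∑< n G
∑-cong-≈[] zero    F≈G = λ _ _ → refl
∑-cong-≈[] (suc n) F≈G =
  ⊕-cong-≈[] (∑-cong-≈[] n (λ i i<n → F≈G i (ℕₚ.m<n⇒m<1+n i<n))) (F≈G n (ℕₚ.n<1+n n))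

∑-zero : ∀ n {F : ℕ → Series} → (∀ i → i < n → F i ≗ 𝟘) → ∑< n F ≗ 𝟘
∑-zero zero    F≗𝟘 = λ _ → refl
∑-zero (suc n) F≗𝟘 j =
  trans (⊕-cong (∑-zero n (λ i i<n → F≗𝟘 i (ℕₚ.m<n⇒m<1+n i<n))) (F≗𝟘 n (ℕₚ.n<1+n n)) j) (ℚₚ.+-identityʳ 0ℚ)

∑-unfoldˡ : ∀ n (F : ℕ → Series) → ∑< (suc n) F ≗ F 0 ⊕ ∑< n (F ∘ suc)
∑-unfoldˡ zero    F = ⊕-comm 𝟘 (F 0)
∑-unfoldˡ (suc n) F j = trans (cong (_+ℚ F (suc n) j) (∑-unfoldˡ n F j))
                              (⊕-assoc (F 0) (∑< n (F ∘ suc)) (F (suc n)) j)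

∑-unfoldˡ-𝟘 : ∀ n (F : ℕ → Series) → F 0 ≗ 𝟘 → ∑< (suc n) F ≗ ∑< n (F ∘ suc)
∑-unfoldˡ-𝟘 n F F0≗𝟘 = ≗-trans (∑-unfoldˡ n F) (≗-trans (⊕-congˡ (∑< n (F ∘ suc)) F0≗𝟘) (⊕-identityˡ _))

∑-single : ∀ n a {F : ℕ → Series} → a < n → (∀ i → i ≢ a → F i ≗ 𝟘) → ∑< n F ≗ F a
∑-single (suc n) a {F} a<1+n others with ℕₚ.m≤n⇒m<n∨m≡n (ℕₚ.≤-pred a<1+n)
... | inj₁ a<n  = ≗-Reasoning.begin
  ∑< n F ⊕ F n  ≈⟨ ⊕-cong (∑-single n a a<n others) (others n (ℕₚ.>⇒≢ a<n)) ⟩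
  F a ⊕ 𝟘        ≈⟨ ⊕-identityʳ (F a) ⟩
  F a            ∎
  where open ≗-Reasoning
... | inj₂ refl = ≗-Reasoning.begin
  ∑< n F ⊕ F n  ≈⟨ ⊕-congˡ (F n) (∑-zero n (λ i i<n → others i (ℕₚ.<⇒≢ i<n))) ⟩
  𝟘 ⊕ F n        ≈⟨ ⊕-identityˡ (F n) ⟩
  F n            ∎
  where open ≗-Reasoning

∑-distrib-⊕ : ∀ n (F G : ℕ → Series) → ∑[ i < n ] (F i ⊕ G i) ≗ ∑< n F ⊕ ∑< n G
∑-distrib-⊕ zero    F G j = sym (ℚₚ.+-identityʳ 0ℚ)
∑-distrib-⊕ (suc n) F G j =
  trans (cong (_+ℚ (F n j +ℚ G n j)) (∑-distrib-⊕ n F G j))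
        (interchange (∑< n F j) (∑< n G j) (F n j) (G n j))
  where open CommutativeSemigroupProperties (CommutativeMonoid.commutativeSemigroup ℚₚ.+-0-commutativeMonoid)
          using (interchange)

∑-comm : ∀ m n (F : ℕ → ℕ → Series) → ∑[ i < m ] ∑[ j < n ] F i j ≗ ∑[ j < n ] ∑[ i < m ] F i j
∑-comm zero    n F = λ j → sym (∑-zero n (λ _ _ _ → refl) j)
∑-comm (suc m) n F j =
  trans (cong (_+ℚ ∑< n (F m) j) (∑-comm m n F j)) (sym (∑-distrib-⊕ n (λ k → ∑[ i < m ] F i k) (F m) j))

⊛-distribˡ-∑ : ∀ n f (F : ℕ → Series) → f ⊛ ∑< n F ≗ ∑[ i < n ] (f ⊛ F i)
⊛-distribˡ-∑ zero    f F = ⊛-zeroʳ f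
⊛-distribˡ-∑ (suc n) f F j =
  trans (⊛-distribˡ-⊕ f (∑< n F) (F n) j) (cong (_+ℚ (f ⊛ F n) j) (⊛-distribˡ-∑ n f F j))

⊛-distribʳ-∑ : ∀ n f (F : ℕ → Series) → ∑< n F ⊛ f ≗ ∑[ i < n ] (F i ⊛ f)
⊛-distribʳ-∑ zero    f F = ⊛-zeroˡ f
⊛-distribʳ-∑ (suc n) f F j =
  trans (⊛-distribʳ-⊕ f (∑< n F) (F n) j) (cong (_+ℚ (F n ⊛ f) j) (⊛-distribʳ-∑ n f F j))

sumFrom1≗∑ : ∀ b (F : ℕ → Series) → sumFrom1 b F ≗ ∑< b (F ∘ suc)
sumFrom1≗∑ zero    F = λ _ → refl
sumFrom1≗∑ (suc b) F j = cong (_+ℚ F (suc b) j) (sumFrom1≗∑ b F j)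

when : Bool → Series → Series
when true  f = f
when false f = 𝟘

when-true : ∀ {b} f → T b → when b f ≗ f
when-true {true} f _ _ = refl

when-false : ∀ {b} f → ¬ T b → when b f ≗ 𝟘
when-false {true}  f ¬b = contradiction _ ¬b
when-false {false} f _  = λ _ → refl

⊛-when : ∀ b f g → f ⊛ when b g ≗ when b (f ⊛ g)
⊛-when true  f g = λ _ → refl
⊛-when false f g = ⊛-zeroʳ f

when-⊛ : ∀ b f g → when b f ⊛ g ≗ when b (f ⊛ g)
when-⊛ true  f g = λ _ → refl
when-⊛ false f g = ⊛-zeroˡ g

∑-when-< : ∀ n k (F : ℕ → Series) → k ≤ n → ∑[ i < n ] when (i <ᵇ k) (F i) ≗ ∑< k F
∑-when-< zero    zero F _ = λ _ → refl
∑-when-< (suc n) k    F k≤1+n with ℕₚ.m≤n⇒m<n∨m≡n k≤1+n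
... | inj₁ k<1+n = ≗-Reasoning.begin
  ∑[ i < n ] when (i <ᵇ k) (F i) ⊕ when (n <ᵇ k) (F n)
    ≈⟨ ⊕-cong (∑-when-< n k F (ℕₚ.≤-pred k<1+n))
              (when-false (F n) (λ n<k → ℕₚ.<⇒≱ (ℕₚ.<ᵇ⇒< n k n<k) (ℕₚ.≤-pred k<1+n))) ⟩
  ∑< k F ⊕ 𝟘
    ≈⟨ ⊕-identityʳ (∑< k F) ⟩
  ∑< k F ∎
  where open ≗-Reasoning
... | inj₂ refl = ∑-cong (suc n) (λ i i<k → when-true (F i) (ℕₚ.<⇒<ᵇ i<k))

∑-when-⊛ʳ : ∀ n k (F : ℕ → Series) g → k ≤ n → ∑< k F ⊛ g ≗ ∑[ i < n ] when (i <ᵇ k) (F i ⊛ g)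
∑-when-⊛ʳ n k F g k≤n = ≗-trans (⊛-congˡ g (≗-sym (∑-when-< n k F k≤n)))
  (≗-trans (⊛-distribʳ-∑ n g _) (∑-cong n (λ i _ → when-⊛ (i <ᵇ k) (F i) g)))

∑-when-⊛ˡ : ∀ n k (F : ℕ → Series) g → k ≤ n → g ⊛ ∑< k F ≗ ∑[ i < n ] when (i <ᵇ k) (g ⊛ F i)
∑-when-⊛ˡ n k F g k≤n = ≗-trans (⊛-congʳ g (≗-sym (∑-when-< n k F k≤n)))
  (≗-trans (⊛-distribˡ-∑ n g _) (∑-cong n (λ i _ → ⊛-when (i <ᵇ k) g (F i))))

-- Geometric series

geometric-sum : ∀ c .{{_ : NonZero c}} n a → a ≤ n →
  ∑[ v < n ] when (a <ᵇ suc v) (qpow (v * c)) ⊕ qpow (n * c) ⊛ invOneMinusQ c ≗ qpow (a * c) ⊛ invOneMinusQ c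
geometric-sum c zero    .zero z≤n = ⊕-identityˡ (qpow 0 ⊛ invOneMinusQ c)
geometric-sum c (suc n) a a≤1+n with ℕₚ.m≤n⇒m<n∨m≡n a≤1+n
... | inj₂ refl = begin
  ∑[ v < suc n ] when (n <ᵇ v) (qpow (v * c)) ⊕ qpow (suc n * c) ⊛ I
    ≈⟨ ⊕-congˡ (qpow (suc n * c) ⊛ I)
         (∑-zero (suc n) (λ v v<1+n → when-false _ (λ n<v → ℕₚ.<⇒≱ (ℕₚ.<ᵇ⇒< n v n<v) (ℕₚ.≤-pred v<1+n)))) ⟩
  𝟘 ⊕ qpow (suc n * c) ⊛ I
    ≈⟨ ⊕-identityˡ _ ⟩
  qpow (suc n * c) ⊛ I ∎
  where
  open ≗-Reasoning
  I = invOneMinusQ c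
... | inj₁ a<1+n = begin
  (∑[ v < n ] when (a <ᵇ suc v) (qpow (v * c)) ⊕ when (a <ᵇ suc n) (qpow (n * c))) ⊕ qpow (c + n * c) ⊛ I
    ≈⟨ ⊕-cong (⊕-congʳ S (when-true _ (ℕₚ.<⇒<ᵇ a<1+n))) nextTerm ⟩
  (S ⊕ qpow (n * c)) ⊕ qpow (n * c) ⊛ (qpow c ⊛ I)
    ≈⟨ ⊕-assoc S (qpow (n * c)) _ ⟩
  S ⊕ (qpow (n * c) ⊕ qpow (n * c) ⊛ (qpow c ⊛ I))
    ≈⟨ ⊕-congʳ S (⊕-congˡ (qpow (n * c) ⊛ (qpow c ⊛ I)) (⊛-identityʳ (qpow (n * c)))) ⟨
  S ⊕ (qpow (n * c) ⊛ one ⊕ qpow (n * c) ⊛ (qpow c ⊛ I))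
    ≈⟨ ⊕-congʳ S (⊛-distribˡ-⊕ (qpow (n * c)) one (qpow c ⊛ I)) ⟨
  S ⊕ qpow (n * c) ⊛ (one ⊕ qpow c ⊛ I)
    ≈⟨ ⊕-congʳ S (⊛-congʳ (qpow (n * c)) (invOneMinusQ-unfold c)) ⟨
  S ⊕ qpow (n * c) ⊛ I
    ≈⟨ geometric-sum c n a (ℕₚ.≤-pred a<1+n) ⟩
  qpow (a * c) ⊛ I ∎
  where
  open ≗-Reasoning
  I = invOneMinusQ c
  S = ∑[ v < n ] when (a <ᵇ suc v) (qpow (v * c))
  nextTerm : qpow (c + n * c) ⊛ I ≗ qpow (n * c) ⊛ (qpow c ⊛ I)
  nextTerm = begin
    qpow (c + n * c) ⊛ I            ≈⟨ ⊛-congˡ I (qpow-+ c (n * c)) ⟨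
    (qpow c ⊛ qpow (n * c)) ⊛ I     ≈⟨ ⊛-congˡ I (⊛-comm (qpow c) (qpow (n * c))) ⟩
    (qpow (n * c) ⊛ qpow c) ⊛ I     ≈⟨ ⊛-assoc (qpow (n * c)) (qpow c) I ⟩
    qpow (n * c) ⊛ (qpow c ⊛ I)     ∎

geometric-tail : ∀ M c .{{_ : NonZero c}} a → a ≤ suc M →
  ∑[ v < suc M ] when (a <ᵇ suc v) (qpow (v * c)) ≈[ M ] qpow (a * c) ⊛ invOneMinusQ c
geometric-tail M c a a≤1+M = begin
  S                                               ≈⟨ ≗⇒≈[] M (⊕-identityʳ S) ⟨
  S ⊕ 𝟘                                           ≈⟨ ⊕-congʳ-≈[] S remainder ⟨
  S ⊕ qpow (suc M * c) ⊛ invOneMinusQ c           ≈⟨ ≗⇒≈[] M (geometric-sum c (suc M) a a≤1+M) ⟩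
  qpow (a * c) ⊛ invOneMinusQ c                   ∎
  where
  open SetoidReasoning (≈[]-setoid M)
  S = ∑[ v < suc M ] when (a <ᵇ suc v) (qpow (v * c))
  remainder : qpow (suc M * c) ⊛ invOneMinusQ c ≈[ M ] 𝟘
  remainder = qpow-⊛-≈[] (invOneMinusQ c) (ℕₚ.m≤m*n (suc M) c)

∑-geometric-swap : ∀ M c .{{_ : NonZero c}} (a : ℕ → ℕ) (f : ℕ → Series) → (∀ i → i < suc M → a i ≤ suc M) →
  ∑[ v < suc M ] (qpow (v * c) ⊛ ∑[ i < suc M ] when (a i <ᵇ suc v) (f i))
    ≈[ M ] ∑[ i < suc M ] (qpow (a i * c) ⊛ invOneMinusQ c ⊛ f i)
∑-geometric-swap M c a f a≤1+M = begin
  ∑[ v < n ] (qpow (v * c) ⊛ ∑[ i < n ] when (a i <ᵇ suc v) (f i))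
    ≈⟨ ≗⇒≈[] M (∑-cong n (λ v _ → ≗-trans (⊛-distribˡ-∑ n (qpow (v * c)) _)
                                           (∑-cong n (λ i _ → ≗-trans (⊛-when (a i <ᵇ suc v) (qpow (v * c)) (f i))
                                                                      (≗-sym (when-⊛ (a i <ᵇ suc v) (qpow (v * c)) (f i))))))) ⟩
  ∑[ v < n ] ∑[ i < n ] (when (a i <ᵇ suc v) (qpow (v * c)) ⊛ f i)
    ≈⟨ ≗⇒≈[] M (∑-comm n n (λ v i → when (a i <ᵇ suc v) (qpow (v * c)) ⊛ f i)) ⟩
  ∑[ i < n ] ∑[ v < n ] (when (a i <ᵇ suc v) (qpow (v * c)) ⊛ f i)
    ≈⟨ ≗⇒≈[] M (∑-cong n (λ i _ → ⊛-distribʳ-∑ n (f i) (λ v → when (a i <ᵇ suc v) (qpow (v * c))))) ⟨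
  ∑[ i < n ] (∑[ v < n ] when (a i <ᵇ suc v) (qpow (v * c)) ⊛ f i)
    ≈⟨ ∑-cong-≈[] n (λ i i<n → ⊛-congˡ-≈[] (f i) (geometric-tail M c (a i) (a≤1+M i i<n))) ⟩
  ∑[ i < n ] (qpow (a i * c) ⊛ invOneMinusQ c ⊛ f i) ∎
  where
  open SetoidReasoning (≈[]-setoid M)
  n = suc M

-- Chain sums with a fixed top index

qOverOneMinusQ : ℕ → Series
qOverOneMinusQ m = qpow m ⊛ invOneMinusQ m

-- strictChain ks m is the part of  Σ_{m₁>⋯>mₙ>0} ∏ 1/(1-q^{mᵢ})^{kᵢ}  with m₁ = m,
-- and weakChain ks m the part of  Σ_{m₁≥⋯≥mₙ≥1} ∏ (q^{mᵢ}/(1-q^{mᵢ}))^{kᵢ}  with m₁ = m;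
-- the empty chain sits at m = 0, resp. m = 1.
strictChain : List ℕ → ℕ → Series
strictChain []       zero    = one
strictChain []       (suc _) = 𝟘
strictChain (k ∷ ks) m       = invOneMinusQ m ^s k ⊛ ∑< m (strictChain ks)

weakChain : List ℕ → ℕ → Series
weakChain []       zero          = 𝟘
weakChain []       (suc zero)    = one
weakChain []       (suc (suc _)) = 𝟘
weakChain (k ∷ ks) m             = qOverOneMinusQ m ^s k ⊛ ∑< (suc m) (weakChain ks)

strictChain-[]-≢0 : ∀ {i} → i ≢ 0 → strictChain [] i ≗ 𝟘
strictChain-[]-≢0 {zero}  0≢0 = contradiction refl 0≢0
strictChain-[]-≢0 {suc i} _   = λ _ → refl

weakChain-[]-≢1 : ∀ {i} → i ≢ 1 → weakChain [] i ≗ 𝟘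
weakChain-[]-≢1 {zero}          _   = λ _ → refl
weakChain-[]-≢1 {suc zero}      1≢1 = contradiction refl 1≢1
weakChain-[]-≢1 {suc (suc i)}   _   = λ _ → refl

strictSum≗∑ : ∀ ks b → strictSum ks b ≗ ∑< (suc b) (strictChain ks)
strictSum≗∑ []       b = ≗-sym (∑-single (suc b) 0 (s≤s z≤n) (λ _ → strictChain-[]-≢0))
strictSum≗∑ (k ∷ ks) b = begin
  sumFrom1 b (λ m → (invOneMinusQ m ^s k) ⊛ strictSum ks (m ∸ 1))
    ≈⟨ sumFrom1≗∑ b _ ⟩
  ∑[ i < b ] (invOneMinusQ (suc i) ^s k ⊛ strictSum ks i)
    ≈⟨ ∑-cong b (λ i _ → ⊛-congʳ (invOneMinusQ (suc i) ^s k) (strictSum≗∑ ks i)) ⟩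
  ∑< b (strictChain (k ∷ ks) ∘ suc)
    ≈⟨ ∑-unfoldˡ-𝟘 b (strictChain (k ∷ ks)) (⊛-zeroʳ (invOneMinusQ 0 ^s k)) ⟨
  ∑< (suc b) (strictChain (k ∷ ks)) ∎
  where open ≗-Reasoning

ζOOZ-partial≗∑ : ∀ M w → ζOOZ-partial M w ≗ ∑[ m < suc M ] (qpow m ⊛ strictChain (toZs w) m)
ζOOZ-partial≗∑ M w with toZs w
... | [] = ≗-sym (begin
  ∑[ m < suc M ] (qpow m ⊛ strictChain [] m)
    ≈⟨ ∑-single (suc M) 0 (s≤s z≤n) (λ m m≢0 → ≗-trans (⊛-congʳ (qpow m) (strictChain-[]-≢0 m≢0)) (⊛-zeroʳ (qpow m))) ⟩
  qpow 0 ⊛ one                                ≈⟨ ⊛-identityʳ (qpow 0) ⟩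
  qpow 0                                      ≈⟨ one≗qpow0 ⟨
  one                                         ∎)
  where open ≗-Reasoning
... | k ∷ ks = begin
  sumFrom1 M (λ m → qpow m ⊛ (invOneMinusQ m ^s k) ⊛ strictSum ks (m ∸ 1))
    ≈⟨ sumFrom1≗∑ M _ ⟩
  ∑[ i < M ] (qpow (suc i) ⊛ (invOneMinusQ (suc i) ^s k) ⊛ strictSum ks i)
    ≈⟨ ∑-cong M (λ i _ → ≗-trans (⊛-assoc (qpow (suc i)) (invOneMinusQ (suc i) ^s k) (strictSum ks i))
                                  (⊛-congʳ (qpow (suc i)) (⊛-congʳ (invOneMinusQ (suc i) ^s k) (strictSum≗∑ ks i)))) ⟩
  ∑[ i < M ] (qpow (suc i) ⊛ strictChain (k ∷ ks) (suc i))
    ≈⟨ ∑-unfoldˡ-𝟘 M _ (⊛⊛-zero₃ (qpow 0) (invOneMinusQ 0 ^s k) (λ _ → refl)) ⟨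
  ∑[ m < suc M ] (qpow m ⊛ strictChain (k ∷ ks) m) ∎
  where open ≗-Reasoning

weakChain-zero : ∀ ks → weakChain ks 0 ≗ 𝟘
weakChain-zero []       = λ _ → refl
weakChain-zero (k ∷ ks) =
  ≗-trans (⊛-congʳ (qOverOneMinusQ 0 ^s k) (≗-trans (⊕-identityˡ _) (weakChain-zero ks))) (⊛-zeroʳ (qOverOneMinusQ 0 ^s k))

weakSum≗∑ : ∀ ks b → (ks ≡ [] → 1 ≤ b) → weakSum ks b ≗ ∑< (suc b) (weakChain ks)
weakSum≗∑ []       b 1≤b = ≗-sym (∑-single (suc b) 1 (s≤s (1≤b refl)) (λ _ → weakChain-[]-≢1))
weakSum≗∑ (k ∷ ks) b _ = begin
  sumFrom1 b (λ m → (qOverOneMinusQ m ^s k) ⊛ weakSum ks m)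
    ≈⟨ sumFrom1≗∑ b _ ⟩
  ∑[ i < b ] (qOverOneMinusQ (suc i) ^s k ⊛ weakSum ks (suc i))
    ≈⟨ ∑-cong b (λ i _ → ⊛-congʳ (qOverOneMinusQ (suc i) ^s k) (weakSum≗∑ ks (suc i) (λ _ → s≤s z≤n))) ⟩
  ∑< b (weakChain (k ∷ ks) ∘ suc)
    ≈⟨ ∑-unfoldˡ-𝟘 b (weakChain (k ∷ ks)) (weakChain-zero (k ∷ ks)) ⟨
  ∑< (suc b) (weakChain (k ∷ ks)) ∎
  where open ≗-Reasoning

EndsWithY : Word → Set
EndsWithY w = ∃[ u ] (w ≡ u ++ [ y ])

InH1 : Word → Set
InH1 w = (w ≡ []) ⊎ EndsWithY w

¬EndsWithY[] : ¬ EndsWithY []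
¬EndsWithY[] ([]    , ())
¬EndsWithY[] (_ ∷ _ , ())

EndsWithY-p∷ : ∀ {w} → EndsWithY (p ∷ w) → EndsWithY w
EndsWithY-p∷ (_ ∷ u , refl) = u , refl

EndsWithY⇒InH1-tail : ∀ {l w} → EndsWithY (l ∷ w) → InH1 w
EndsWithY⇒InH1-tail ([]    , refl) = inj₁ refl
EndsWithY⇒InH1-tail (_ ∷ u , refl) = inj₂ (u , refl)

-- ooz w u and sz x v are the O(w; u) and S(x; v) of the header, built letter by letter.
ooz : Word → ℕ → Series
ooz []      u = strictChain [] u
ooz (p ∷ w) u = invOneMinusQ u ⊛ ooz w u
ooz (y ∷ w) u = ∑< u (ooz w)

sz : Word → ℕ → Series
sz []      v = weakChain [] v
sz (p ∷ x) v = qOverOneMinusQ v ⊛ sz x v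
sz (y ∷ x) v = ∑< (suc v) (sz x)

ooz-zero : ∀ w → EndsWithY w → ooz w 0 ≗ 𝟘
ooz-zero []      w-y = contradiction w-y ¬EndsWithY[]
ooz-zero (p ∷ w) w-y = ≗-trans (⊛-congʳ (invOneMinusQ 0) (ooz-zero w (EndsWithY-p∷ w-y))) (⊛-zeroʳ (invOneMinusQ 0))
ooz-zero (y ∷ w) _   = λ _ → refl

sz-zero : ∀ x → sz x 0 ≗ 𝟘
sz-zero []      = λ _ → refl
sz-zero (p ∷ x) = ≗-trans (⊛-congʳ (qOverOneMinusQ 0) (sz-zero x)) (⊛-zeroʳ (qOverOneMinusQ 0))
sz-zero (y ∷ x) = ≗-trans (⊕-identityˡ (sz x 0)) (sz-zero x)

invOneMinusQ0-^s : ∀ c → invOneMinusQ 0 ^s c ≗ one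
invOneMinusQ0-^s zero    = λ _ → refl
invOneMinusQ0-^s (suc c) = ≗-trans (⊛-cong invOneMinusQ-zero (invOneMinusQ0-^s c)) (⊛-identityˡ one)

-- Holds for every word: a trailing p contributes invOneMinusQ 0, which is one since 0 ∣ j only for j = 0.
strictChain-toZs′ : ∀ c w u → strictChain (toZs′ c w) u ≗ invOneMinusQ u ^s c ⊛ ooz w u
strictChain-toZs′ c []      zero    = ≗-sym (≗-trans (⊛-congˡ one (invOneMinusQ0-^s c)) (⊛-identityˡ one))
strictChain-toZs′ c []      (suc u) = ≗-sym (⊛-zeroʳ (invOneMinusQ (suc u) ^s c))
strictChain-toZs′ c (p ∷ w) u       =
  ≗-trans (strictChain-toZs′ (suc c) w u)
          (solve 3 (λ I Iᶜ R → (I ⊙ Iᶜ) ⊙ R ⊜ Iᶜ ⊙ (I ⊙ R)) (λ _ → refl)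
                 (invOneMinusQ u) (invOneMinusQ u ^s c) (ooz w u))
strictChain-toZs′ c (y ∷ w) u       =
  ⊛-congʳ (invOneMinusQ u ^s c) (∑-cong u (λ i _ → ≗-trans (strictChain-toZs′ 0 w i) (⊛-identityˡ (ooz w i))))

ζOOZ-partial≗∑ooz : ∀ M w → ζOOZ-partial M w ≗ ∑[ m < suc M ] (qpow m ⊛ ooz w m)
ζOOZ-partial≗∑ooz M w = ≗-trans (ζOOZ-partial≗∑ M w)
  (∑-cong (suc M) (λ m _ → ⊛-congʳ (qpow m) (≗-trans (strictChain-toZs′ 0 w m) (⊛-identityˡ (ooz w m)))))

mutual
  weakChain-toZs′ : ∀ c x → EndsWithY x → ∀ v → weakChain (toZs′ c x) v ≗ qOverOneMinusQ v ^s c ⊛ sz x v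
  weakChain-toZs′ c []      x-y v = contradiction x-y ¬EndsWithY[]
  weakChain-toZs′ c (p ∷ x) x-y v =
    ≗-trans (weakChain-toZs′ (suc c) x (EndsWithY-p∷ x-y) v)
            (solve 3 (λ Q Qᶜ L → (Q ⊙ Qᶜ) ⊙ L ⊜ Qᶜ ⊙ (Q ⊙ L)) (λ _ → refl)
                   (qOverOneMinusQ v) (qOverOneMinusQ v ^s c) (sz x v))
  weakChain-toZs′ c (y ∷ x) x-y v =
    ⊛-congʳ (qOverOneMinusQ v ^s c) (∑-cong (suc v) (λ i _ → weakChain-toZs x (EndsWithY⇒InH1-tail x-y) i))

  weakChain-toZs : ∀ x → InH1 x → ∀ v → weakChain (toZs x) v ≗ sz x v
  weakChain-toZs .[] (inj₁ refl) v = λ _ → refl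
  weakChain-toZs x   (inj₂ x-y)  v = ≗-trans (weakChain-toZs′ 0 x x-y v) (⊛-identityˡ (sz x v))

toZs′-nonempty : ∀ c x → EndsWithY x → toZs′ c x ≢ []
toZs′-nonempty c []      x-y = contradiction x-y ¬EndsWithY[]
toZs′-nonempty c (p ∷ x) x-y = toZs′-nonempty (suc c) x (EndsWithY-p∷ x-y)
toZs′-nonempty c (y ∷ x) _   = λ ()

ζSZ⋆-partial≗∑sz : ∀ M x → EndsWithY x → ζSZ⋆-partial M x ≗ ∑< (suc M) (sz x)
ζSZ⋆-partial≗∑sz M x x-y =
  ≗-trans (weakSum≗∑ (toZs x) M (λ toZs≡[] → contradiction toZs≡[] (toZs′-nonempty 0 x x-y)))
          (∑-cong (suc M) (λ v _ → weakChain-toZs x (inj₂ x-y) v))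

-- The connected sum

connectedSum : ℕ → Word → Word → Series
connectedSum M x w = ∑[ v < suc M ] ∑[ u < suc M ] (qpow (v * u) ⊛ (sz x v ⊛ ooz w u))

connectedSum-[]ʳ : ∀ M x → connectedSum M x [] ≗ ∑< (suc M) (sz x)
connectedSum-[]ʳ M x = ∑-cong (suc M) (λ v _ → row v)
  where
  row : ∀ v → ∑[ u < suc M ] (qpow (v * u) ⊛ (sz x v ⊛ ooz [] u)) ≗ sz x v
  row v = begin
    ∑[ u < suc M ] (qpow (v * u) ⊛ (sz x v ⊛ ooz [] u))
      ≈⟨ ∑-single (suc M) 0 (s≤s z≤n) (λ u u≢0 → ⊛⊛-zero₃ (qpow (v * u)) (sz x v) (strictChain-[]-≢0 u≢0)) ⟩
    qpow (v * 0) ⊛ (sz x v ⊛ one)                        ≈⟨ ⊛-cong (qpow-cong (ℕₚ.*-zeroʳ v)) (⊛-identityʳ (sz x v)) ⟩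
    qpow 0 ⊛ sz x v                                      ≈⟨ ⊛-congˡ (sz x v) one≗qpow0 ⟨
    one ⊛ sz x v                                         ≈⟨ ⊛-identityˡ (sz x v) ⟩
    sz x v                                               ∎
    where open ≗-Reasoning

connectedSum-[]ˡ : ∀ M w → ooz w 0 ≗ 𝟘 → connectedSum M [] w ≗ ∑[ u < suc M ] (qpow u ⊛ ooz w u)
connectedSum-[]ˡ zero w w₀ =
  ≗-trans (∑-zero 1 (λ v v<1 → row≗𝟘 v (ℕₚ.<⇒≢ v<1)))
          (≗-sym (≗-trans (⊕-identityˡ _) (≗-trans (⊛-congʳ (qpow 0) w₀) (⊛-zeroʳ (qpow 0)))))
  where
  row≗𝟘 : ∀ v → v ≢ 1 → ∑[ u < 1 ] (qpow (v * u) ⊛ (sz [] v ⊛ ooz w u)) ≗ 𝟘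
  row≗𝟘 v v≢1 = ∑-zero 1 (λ u _ → ⊛⊛-zero₂ (qpow (v * u)) (ooz w u) (weakChain-[]-≢1 v≢1))
connectedSum-[]ˡ (suc M) w _ =
  ≗-trans (∑-single (suc (suc M)) 1 (s≤s (s≤s z≤n)) row≗𝟘)
          (∑-cong (suc (suc M)) (λ u _ → ⊛-cong (qpow-cong (ℕₚ.*-identityˡ u)) (⊛-identityˡ (ooz w u))))
  where
  row≗𝟘 : ∀ v → v ≢ 1 → ∑[ u < suc (suc M) ] (qpow (v * u) ⊛ (sz [] v ⊛ ooz w u)) ≗ 𝟘
  row≗𝟘 v v≢1 = ∑-zero (suc (suc M)) (λ u _ → ⊛⊛-zero₂ (qpow (v * u)) (ooz w u) (weakChain-[]-≢1 v≢1))

transfer-p : ∀ M x w → ooz w 0 ≗ 𝟘 → connectedSum M x (p ∷ w) ≈[ M ] connectedSum M (y ∷ x) w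
transfer-p M x w w₀ = begin
  ∑[ v < n ] ∑[ u < n ] (qpow (v * u) ⊛ (sz x v ⊛ (invOneMinusQ u ⊛ ooz w u)))
    ≈⟨ ≗⇒≈[] M (∑-comm n n _) ⟩
  ∑[ u < n ] ∑[ v < n ] (qpow (v * u) ⊛ (sz x v ⊛ (invOneMinusQ u ⊛ ooz w u)))
    ≈⟨ ∑-cong-≈[] n (λ u _ → column u) ⟨
  ∑[ u < n ] ∑[ v < n ] (qpow (v * u) ⊛ (∑< (suc v) (sz x) ⊛ ooz w u))
    ≈⟨ ≗⇒≈[] M (∑-comm n n _) ⟨
  ∑[ v < n ] ∑[ u < n ] (qpow (v * u) ⊛ (∑< (suc v) (sz x) ⊛ ooz w u)) ∎
  where
  open SetoidReasoning (≈[]-setoid M)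
  n = suc M
  column : ∀ u → ∑[ v < n ] (qpow (v * u) ⊛ (∑< (suc v) (sz x) ⊛ ooz w u))
                   ≈[ M ] ∑[ v < n ] (qpow (v * u) ⊛ (sz x v ⊛ (invOneMinusQ u ⊛ ooz w u)))
  column zero = ≗⇒≈[] M (≗-trans (∑-zero n (λ v _ → ⊛⊛-zero₃ (qpow (v * 0)) (∑< (suc v) (sz x)) w₀))
    (≗-sym (∑-zero n (λ v _ → ⊛⊛-zero₃ (qpow (v * 0)) (sz x v) (≗-trans (⊛-congʳ (invOneMinusQ 0) w₀) (⊛-zeroʳ (invOneMinusQ 0)))))))
  column u@(suc _) = begin
    ∑[ v < n ] (qpow (v * u) ⊛ (∑< (suc v) (sz x) ⊛ ooz w u))
      ≈⟨ ≗⇒≈[] M (∑-cong n (λ v v<n → ⊛-congʳ (qpow (v * u)) (∑-when-⊛ʳ n (suc v) (sz x) (ooz w u) v<n))) ⟩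
    ∑[ v < n ] (qpow (v * u) ⊛ ∑[ i < n ] when (i <ᵇ suc v) (sz x i ⊛ ooz w u))
      ≈⟨ ∑-geometric-swap M u id (λ i → sz x i ⊛ ooz w u) (λ _ → ℕₚ.<⇒≤) ⟩
    ∑[ i < n ] (qpow (i * u) ⊛ invOneMinusQ u ⊛ (sz x i ⊛ ooz w u))
      ≈⟨ ≗⇒≈[] M (∑-cong n (λ i _ → solve 4 (λ Q I L R → (Q ⊙ I) ⊙ (L ⊙ R) ⊜ Q ⊙ (L ⊙ (I ⊙ R))) (λ _ → refl)
                                             (qpow (i * u)) (invOneMinusQ u) (sz x i) (ooz w u))) ⟩
    ∑[ i < n ] (qpow (i * u) ⊛ (sz x i ⊛ (invOneMinusQ u ⊛ ooz w u))) ∎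

transfer-y : ∀ M x w → connectedSum M x (y ∷ w) ≈[ M ] connectedSum M (p ∷ x) w
transfer-y M x w = ∑-cong-≈[] n (λ v _ → row v)
  where
  n = suc M
  row : ∀ v → ∑[ u < n ] (qpow (v * u) ⊛ (sz x v ⊛ ∑< u (ooz w)))
                ≈[ M ] ∑[ u < n ] (qpow (v * u) ⊛ (qOverOneMinusQ v ⊛ sz x v ⊛ ooz w u))
  row zero = ≗⇒≈[] M (≗-trans (∑-zero n (λ u _ → ⊛⊛-zero₂ (qpow 0) (∑< u (ooz w)) (sz-zero x)))
    (≗-sym (∑-zero n (λ u _ → ⊛⊛-zero₂ (qpow 0) (ooz w u)
                                 (≗-trans (⊛-congʳ (qOverOneMinusQ 0) (sz-zero x)) (⊛-zeroʳ (qOverOneMinusQ 0)))))))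
  row v@(suc _) = begin
    ∑[ u < n ] (qpow (v * u) ⊛ (sz x v ⊛ ∑< u (ooz w)))
      ≈⟨ ≗⇒≈[] M (∑-cong n (λ u u<n → ⊛-cong (qpow-cong (ℕₚ.*-comm v u))
                                             (∑-when-⊛ˡ n u (ooz w) (sz x v) (ℕₚ.<⇒≤ u<n)))) ⟩
    ∑[ u < n ] (qpow (u * v) ⊛ ∑[ i < n ] when (i <ᵇ u) (sz x v ⊛ ooz w i))
      ≈⟨ ∑-geometric-swap M v suc (λ i → sz x v ⊛ ooz w i) (λ _ i<n → i<n) ⟩
    ∑[ i < n ] (qpow (suc i * v) ⊛ invOneMinusQ v ⊛ (sz x v ⊛ ooz w i))
      ≈⟨ ≗⇒≈[] M (∑-cong n (λ i _ → regroup i)) ⟩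
    ∑[ i < n ] (qpow (v * i) ⊛ (qOverOneMinusQ v ⊛ sz x v ⊛ ooz w i)) ∎
    where
    open SetoidReasoning (≈[]-setoid M)
    regroup : ∀ i → qpow (suc i * v) ⊛ invOneMinusQ v ⊛ (sz x v ⊛ ooz w i)
                      ≗ qpow (v * i) ⊛ (qOverOneMinusQ v ⊛ sz x v ⊛ ooz w i)
    regroup i = ≗-trans
      (⊛-congˡ (sz x v ⊛ ooz w i) (⊛-congˡ (invOneMinusQ v)
        (≗-trans (≗-sym (qpow-+ v (i * v))) (⊛-congʳ (qpow v) (qpow-cong (ℕₚ.*-comm i v))))))
      (solve 5 (λ Q A I L R → ((Q ⊙ A) ⊙ I) ⊙ (L ⊙ R) ⊜ A ⊙ (((Q ⊙ I) ⊙ L) ⊙ R)) (λ _ → refl)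
             (qpow v) (qpow (v * i)) (invOneMinusQ v) (sz x v) (ooz w i))

τ̃-∷-++ : ∀ l w x → τ̃ (l ∷ w) ++ x ≡ τ̃ w ++ (swap l ∷ x)
τ̃-∷-++ l w x = trans (cong (_++ x) (Listₚ.unfold-reverse (swap l) (map swap w)))
                     (Listₚ.++-assoc (τ̃ w) [ swap l ] x)

τ̃-p∷-++-y : ∀ u → τ̃ (p ∷ (u ++ [ y ])) ≡ p ∷ (τ̃ u ++ [ y ])
τ̃-p∷-++-y u = trans (Listₚ.unfold-reverse y (map swap (u ++ [ y ])))
  (cong (_++ [ y ]) (trans (cong reverse (Listₚ.map-++ swap u [ y ])) (Listₚ.reverse-++ (map swap u) [ p ])))

transfer : ∀ M x w → InH1 w → connectedSum M x w ≈[ M ] connectedSum M (τ̃ w ++ x) []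
transfer M x []      _           = λ _ _ → refl
transfer M x (l ∷ w) (inj₁ ())
transfer M x (p ∷ w) (inj₂ pw-y) = begin
  connectedSum M x (p ∷ w)              ≈⟨ transfer-p M x w (ooz-zero w w-y) ⟩
  connectedSum M (y ∷ x) w              ≈⟨ transfer M (y ∷ x) w (inj₂ w-y) ⟩
  connectedSum M (τ̃ w ++ y ∷ x) []      ≡⟨ cong (λ x′ → connectedSum M x′ []) (τ̃-∷-++ p w x) ⟨
  connectedSum M (τ̃ (p ∷ w) ++ x) []    ∎
  where
  open SetoidReasoning (≈[]-setoid M)
  w-y = EndsWithY-p∷ pw-y
transfer M x (y ∷ w) (inj₂ yw-y) = begin
  connectedSum M x (y ∷ w)              ≈⟨ transfer-y M x w ⟩
  connectedSum M (p ∷ x) w              ≈⟨ transfer M (p ∷ x) w (EndsWithY⇒InH1-tail yw-y) ⟩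
  connectedSum M (τ̃ w ++ p ∷ x) []      ≡⟨ cong (λ x′ → connectedSum M x′ []) (τ̃-∷-++ y w x) ⟨
  connectedSum M (τ̃ (y ∷ w) ++ x) []    ∎
  where open SetoidReasoning (≈[]-setoid M)

theorem5p5 : (w : Word) → InH0 w → (N M : ℕ) → N ≤ M →
    ζOOZ-partial M w N ≡ ζSZ⋆-partial M (τ̃ w) N
theorem5p5 .[] (inj₁ refl) N M _ = refl
theorem5p5 .(p ∷ (u ++ [ y ])) (inj₂ (u , refl)) N M N≤M = ζOOZ≈ζSZ⋆ N N≤M
  where
  w = p ∷ (u ++ [ y ])
  w-y : EndsWithY w
  w-y = p ∷ u , refl
  τ̃w-y : EndsWithY (τ̃ w)
  τ̃w-y = p ∷ τ̃ u , τ̃-p∷-++-y u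
  open SetoidReasoning (≈[]-setoid M)
  ζOOZ≈ζSZ⋆ : ζOOZ-partial M w ≈[ M ] ζSZ⋆-partial M (τ̃ w)
  ζOOZ≈ζSZ⋆ = begin
    ζOOZ-partial M w                     ≈⟨ ≗⇒≈[] M (ζOOZ-partial≗∑ooz M w) ⟩
    ∑[ m < suc M ] (qpow m ⊛ ooz w m)    ≈⟨ ≗⇒≈[] M (connectedSum-[]ˡ M w (ooz-zero w w-y)) ⟨
    connectedSum M [] w                  ≈⟨ transfer M [] w (inj₂ w-y) ⟩
    connectedSum M (τ̃ w ++ []) []        ≡⟨ cong (λ x → connectedSum M x []) (Listₚ.++-identityʳ (τ̃ w)) ⟩
    connectedSum M (τ̃ w) []              ≈⟨ ≗⇒≈[] M (connectedSum-[]ʳ M (τ̃ w)) ⟩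
    ∑< (suc M) (sz (τ̃ w))               ≈⟨ ≗⇒≈[] M (ζSZ⋆-partial≗∑sz M (τ̃ w) τ̃w-y) ⟨
    ζSZ⋆-partial M (τ̃ w)                ∎
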